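{- For $d\in\mathbb{N}$ let $P_d=\frac{1}{2^d d!}\frac{\mathrm{d}^d}{\mathrm{d}X^d}\big((X^2-1)^d\big)\in\mathbb{Q}[X]$ (the Legendre polynomial of index $d$). Let $d\geq1$ be an integer. If $d$ is even, the $d$ roots of $P_d$ are all irrational; if $d$ is odd, the $d-1$ nonzero roots of $P_d$ are all irrational. -}

module Defs where

open import Data.Nat as ℕ using (ℕ; zero; suc; _!)
open import Data.Nat.Properties using (m*n≢0; m^n≢0; _!≢0)
open import Data.Integer using (+_)
open import Data.Rational using (ℚ; 0ℚ; 1ℚ; _+_; _*_; -_; _/_)
open import Data.List using (List; []; _∷_)

-- Univariate polynomials over ℚ, as coefficient lists, lowest degree first:
-- a₀ ∷ a₁ ∷ … ∷ aₙ ∷ []  represents  a₀ + a₁ X + … + aₙ Xⁿ.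
Poly : Set
Poly = List ℚ

infixl 6 _⊕_
infixl 7 _⊛_ _·_

_⊕_ : Poly → Poly → Poly
[] ⊕ q = q
p ⊕ [] = p
(a ∷ p) ⊕ (b ∷ q) = (a + b) ∷ (p ⊕ q)

_·_ : ℚ → Poly → Poly
c · [] = []
c · (a ∷ p) = (c * a) ∷ (c · p)

_⊛_ : Poly → Poly → Poly
[] ⊛ q = []
(a ∷ p) ⊛ q = (a · q) ⊕ (0ℚ ∷ (p ⊛ q))

_^ₚ_ : Poly → ℕ → Poly
p ^ₚ zero = 1ℚ ∷ []
p ^ₚ suc n = p ⊛ (p ^ₚ n)

derivFrom : ℕ → Poly → Poly
derivFrom k [] = []
derivFrom k (a ∷ p) = ((+ k / 1) * a) ∷ derivFrom (suc k) p

deriv : Poly → Poly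
deriv [] = []
deriv (a ∷ p) = derivFrom 1 p

derivⁿ : ℕ → Poly → Poly
derivⁿ zero p = p
derivⁿ (suc n) p = deriv (derivⁿ n p)

eval : Poly → ℚ → ℚ
eval [] x = 0ℚ
eval (a ∷ p) x = a + x * eval p x

X²-1 : Poly
X²-1 = (- 1ℚ) ∷ 0ℚ ∷ 1ℚ ∷ []

legendre : ℕ → Poly
legendre d = coeff · derivⁿ d (X²-1 ^ₚ d)
  where
  coeff : ℚ
  coeff = (+ 1 / (2 ℕ.^ d ℕ.* d !)) {{m*n≢0 (2 ℕ.^ d) (d !) {{m^n≢0 2 d}} {{d !≢0}}}}

-- By the Leibniz rule, the d-th derivative of (X - 1)ᵈ (X + 1)ᵈ is
-- d! Σₖ C(d,k)² (X - 1)ᵈ⁻ᵏ (X + 1)ᵏ, so a rational root x of P_d gives, writing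
-- x = 1 + 2u, a rational zero u of F(u, u + 1), where F(x, y) = Σₖ C(d,k)² xᵈ⁻ᵏ yᵏ.
-- Clearing the denominator of u = a/c gives F(a, b) = 0 with a and b = a + c coprime.
-- All terms of F(a, b) but bᵈ are divisible by a, and all but aᵈ by b, so a ∣ bᵈ and
-- b ∣ aᵈ; hence a = -1 and c = 2, that is u = -1/2 and x = 0.
-- For even d, 0 is not a root either: P_d(0) is a nonzero multiple of the
-- coefficient ±C(d, d/2) of Xᵈ in (X² - 1)ᵈ.
module Submission where

open import Data.Nat using (ℕ; _≥_)
open import Data.Rational using (ℚ; 0ℚ)
open import Relation.Binary.PropositionalEquality using (_≡_; _≢_)
open import Data.Nat.Divisibility using (_∣_)
open import Relation.Nullary using (¬_)

open import Defs

open import Algebra.Bundles using (CommutativeMonoid; CommutativeSemiring)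
open import Algebra.Morphism.Structures using (IsSemiringHomomorphism)
open import Data.Nat.Base as ℕ using (zero; suc; _∸_; _!; _≤_; z≤n)
open import Data.Nat.Combinatorics
  using (_C_; nCn≡1; nCk≡nC[n∸k]; k![n∸k]!∣n!; nCk+nC[k+1]≡[n+1]C[k+1])
open import Data.Nat.Combinatorics.Base using (_P′_)
open import Data.Nat.Combinatorics.Specification using (nP′k≡n!/[n∸k]!; nCk≡n!/k![n-k]!; k>n⇒nCk≡0)
open import Data.Nat.DivMod using (m/n*n≡m)
open import Data.Nat.Divisibility using (divides; m≤n⇒m!∣n!; ∣1⇒≡1)
import Data.Nat.Properties as ℕ
import Data.Nat.Tactic.RingSolver as ℕ
open import Function.Base using (_∘_)
open import Relation.Binary.PropositionalEquality using (refl; sym; trans; cong; cong₂; subst; module ≡-Reasoning)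

infixl 6.5 _C²_
_C²_ : ℕ → ℕ → ℕ
n C² k = (n C k) ℕ.* (n C k)

nCk*k!*[n∸k]!≡n! : ∀ {n k} → k ≤ n → (n C k) ℕ.* (k ! ℕ.* (n ∸ k) !) ≡ n !
nCk*k!*[n∸k]!≡n! {n} {k} k≤n = begin
  (n C k) ℕ.* (k ! ℕ.* (n ∸ k) !)
    ≡⟨ cong (ℕ._* (k ! ℕ.* (n ∸ k) !)) (nCk≡n!/k![n-k]! k≤n) ⟩
  (n ! ℕ./ (k ! ℕ.* (n ∸ k) !)) ℕ.* (k ! ℕ.* (n ∸ k) !)
    ≡⟨ m/n*n≡m (k![n∸k]!∣n! k≤n) ⟩
  n !
    ∎
  where
  open ≡-Reasoning
  instance _ = k ℕ.!* (n ∸ k) !≢0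

nP′k*[n∸k]!≡n! : ∀ {n k} → k ≤ n → (n P′ k) ℕ.* (n ∸ k) ! ≡ n !
nP′k*[n∸k]!≡n! {n} {k} k≤n = begin
  (n P′ k) ℕ.* (n ∸ k) !                 ≡⟨ cong (ℕ._* (n ∸ k) !) (nP′k≡n!/[n∸k]! k≤n) ⟩
  (n ! ℕ./ (n ∸ k) !) ℕ.* (n ∸ k) !      ≡⟨ m/n*n≡m (m≤n⇒m!∣n! (ℕ.m∸n≤m n k)) ⟩
  n !                                    ∎
  where
  open ≡-Reasoning
  instance _ = (n ∸ k) ℕ.!≢0

nP′k≡nCk*k! : ∀ {n k} → k ≤ n → n P′ k ≡ (n C k) ℕ.* k !
nP′k≡nCk*k! {n} {k} k≤n = ℕ.*-cancelʳ-≡ (n P′ k) ((n C k) ℕ.* k !) ((n ∸ k) !) {{(n ∸ k) ℕ.!≢0}}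
  (trans (nP′k*[n∸k]!≡n! k≤n) (trans (sym (nCk*k!*[n∸k]!≡n! k≤n)) (sym (ℕ.*-assoc (n C k) (k !) _))))

nCk*nP′k*nP′[n∸k]≡n!*nC²k : ∀ {n k} → k ≤ n →
  (n C k) ℕ.* ((n P′ k) ℕ.* (n P′ (n ∸ k))) ≡ n ! ℕ.* (n C² k)
nCk*nP′k*nP′[n∸k]≡n!*nC²k {n} {k} k≤n = begin
  (n C k) ℕ.* ((n P′ k) ℕ.* (n P′ (n ∸ k)))
    ≡⟨ cong₂ (λ x y → (n C k) ℕ.* (x ℕ.* y)) (nP′k≡nCk*k! k≤n) (nP′k≡nCk*k! (ℕ.m∸n≤m n k)) ⟩
  (n C k) ℕ.* (((n C k) ℕ.* k !) ℕ.* ((n C (n ∸ k)) ℕ.* (n ∸ k) !))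
    ≡⟨ cong (λ c → (n C k) ℕ.* (((n C k) ℕ.* k !) ℕ.* (c ℕ.* (n ∸ k) !))) (nCk≡nC[n∸k] k≤n) ⟨
  (n C k) ℕ.* (((n C k) ℕ.* k !) ℕ.* ((n C k) ℕ.* (n ∸ k) !))
    ≡⟨ rearrange (n C k) (k !) ((n ∸ k) !) ⟩
  ((n C k) ℕ.* (k ! ℕ.* (n ∸ k) !)) ℕ.* (n C² k)
    ≡⟨ cong (ℕ._* (n C² k)) (nCk*k!*[n∸k]!≡n! k≤n) ⟩
  n ! ℕ.* (n C² k)
    ∎
  where
  open ≡-Reasoning
  rearrange : ∀ c a b → c ℕ.* ((c ℕ.* a) ℕ.* (c ℕ.* b)) ≡ (c ℕ.* (a ℕ.* b)) ℕ.* (c ℕ.* c)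
  rearrange = ℕ.solve-∀

nCk≢0 : ∀ {n k} → k ≤ n → n C k ≢ 0
nCk≢0 {n} {k} k≤n nCk≡0 = ℕ.≢-nonZero⁻¹ (n !) {{n ℕ.!≢0}}
  (trans (sym (nCk*k!*[n∸k]!≡n! k≤n)) (cong (ℕ._* (k ! ℕ.* (n ∸ k) !)) nCk≡0))

module RangeSum {c ℓ} (M : CommutativeMonoid c ℓ) where

  open CommutativeMonoid M renaming (refl to ≈-refl; sym to ≈-sym; trans to ≈-trans; reflexive to ≈-reflexive)
  open import Algebra.Properties.CommutativeSemigroup commutativeSemigroup using (interchange; x∙yz≈y∙xz)
  open import Algebra.Properties.Monoid.Mult monoid using (_×_; ×-homo-+)
  open import Algebra.Properties.CommutativeMonoid.Mult M using (×-distrib-+)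
  open import Relation.Binary.Reasoning.Setoid setoid

  ∑ : ℕ → (ℕ → Carrier) → Carrier
  ∑ zero    f = f 0
  ∑ (suc n) f = ∑ n f ∙ f (suc n)

  ∑-cong : ∀ n {f g} → (∀ {k} → k ≤ n → f k ≈ g k) → ∑ n f ≈ ∑ n g
  ∑-cong zero    f≈g = f≈g z≤n
  ∑-cong (suc n) f≈g = ∙-cong (∑-cong n (f≈g ∘ ℕ.m≤n⇒m≤1+n)) (f≈g ℕ.≤-refl)

  ∑-unconsˡ : ∀ n f → ∑ (suc n) f ≈ f 0 ∙ ∑ n (f ∘ suc)
  ∑-unconsˡ zero    f = ≈-refl
  ∑-unconsˡ (suc n) f = begin
    ∑ (suc n) f ∙ f (suc (suc n))            ≈⟨ ∙-congʳ (∑-unconsˡ n f) ⟩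
    (f 0 ∙ ∑ n (f ∘ suc)) ∙ f (suc (suc n))  ≈⟨ assoc _ _ _ ⟩
    f 0 ∙ ∑ (suc n) (f ∘ suc)                ∎

  ∑-distrib : ∀ n f g → ∑ n (λ k → f k ∙ g k) ≈ ∑ n f ∙ ∑ n g
  ∑-distrib zero    f g = ≈-refl
  ∑-distrib (suc n) f g = begin
    ∑ n (λ k → f k ∙ g k) ∙ (f (suc n) ∙ g (suc n))  ≈⟨ ∙-congʳ (∑-distrib n f g) ⟩
    (∑ n f ∙ ∑ n g) ∙ (f (suc n) ∙ g (suc n))        ≈⟨ interchange _ _ _ _ ⟩
    ∑ (suc n) f ∙ ∑ (suc n) g                        ∎

  ×-distrib-∑ : ∀ m n f → m × ∑ n f ≈ ∑ n (λ k → m × f k)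
  ×-distrib-∑ m zero    f = ≈-refl
  ×-distrib-∑ m (suc n) f = begin
    m × (∑ n f ∙ f (suc n))        ≈⟨ ×-distrib-+ (∑ n f) (f (suc n)) m ⟩
    m × ∑ n f ∙ m × f (suc n)      ≈⟨ ∙-congʳ (×-distrib-∑ m n f) ⟩
    ∑ (suc n) (λ k → m × f k)      ∎

  ∑-pascal : ∀ n (h : ℕ → Carrier) →
    ∑ (suc n) (λ k → (suc n C k) × h k) ≈ ∑ n (λ k → (n C k) × h (suc k)) ∙ ∑ n (λ k → (n C k) × h k)
  ∑-pascal n h = begin
    ∑ (suc n) (λ k → (suc n C k) × h k)                       ≈⟨ ∑-unconsˡ n _ ⟩
    g 0 ∙ ∑ n (λ k → (suc n C suc k) × h (suc k))             ≈⟨ ∙-congˡ (∑-cong n λ {k} _ → split k) ⟩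
    g 0 ∙ ∑ n (λ k → (n C k) × h (suc k) ∙ g (suc k))         ≈⟨ ∙-congˡ (∑-distrib n _ _) ⟩
    g 0 ∙ (∑ n (λ k → (n C k) × h (suc k)) ∙ ∑ n (g ∘ suc))   ≈⟨ x∙yz≈y∙xz _ _ _ ⟩
    ∑ n (λ k → (n C k) × h (suc k)) ∙ (g 0 ∙ ∑ n (g ∘ suc))   ≈⟨ ∙-congˡ (∑-unconsˡ n g) ⟨
    ∑ n (λ k → (n C k) × h (suc k)) ∙ (∑ n g ∙ g (suc n))     ≈⟨ ∙-congˡ (∙-congˡ vanish) ⟩
    ∑ n (λ k → (n C k) × h (suc k)) ∙ (∑ n g ∙ ε)             ≈⟨ ∙-congˡ (identityʳ _) ⟩
    ∑ n (λ k → (n C k) × h (suc k)) ∙ ∑ n g                   ∎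
    where
    g : ℕ → Carrier
    g k = (n C k) × h k
    split : ∀ k → (suc n C suc k) × h (suc k) ≈ (n C k) × h (suc k) ∙ g (suc k)
    split k = begin
      (suc n C suc k) × h (suc k)             ≡⟨ cong (_× h (suc k)) (nCk+nC[k+1]≡[n+1]C[k+1] n k) ⟨
      (n C k ℕ.+ n C suc k) × h (suc k)       ≈⟨ ×-homo-+ (h (suc k)) (n C k) (n C suc k) ⟩
      (n C k) × h (suc k) ∙ g (suc k)         ∎
    vanish : g (suc n) ≈ ε
    vanish = ≈-reflexive (cong (_× h (suc n)) (k>n⇒nCk≡0 (ℕ.n<1+n n)))

-- The form Σₖ C(d,k)² xᵈ⁻ᵏ yᵏ

module Binomial²Form {c ℓ} (R : CommutativeSemiring c ℓ) where

  open CommutativeSemiring R renaming (refl to ≈-refl; sym to ≈-sym; trans to ≈-trans)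
  open RangeSum +-commutativeMonoid using (∑; ∑-cong; ∑-unconsˡ)
  open import Algebra.Properties.CommutativeSemigroup *-commutativeSemigroup
    using () renaming (interchange to *-interchange; x∙yz≈y∙xz to x*yz≈y*xz)
  open import Algebra.Properties.Semiring.Mult semiring using (_×_; ×-homo-1; ×-comm-*; ×-congʳ)
  open import Algebra.Properties.CommutativeSemiring.Exp R using (_^_; ^-distrib-*; ^-homo-*; ^-congʳ)
  open import Relation.Binary.Reasoning.Setoid setoid

  binomial²Form : ℕ → Carrier → Carrier → Carrier
  binomial²Form d x y = ∑ d (λ k → (d C² k) × (x ^ (d ∸ k) * y ^ k))

  *-distribˡ-∑ : ∀ t n f → t * ∑ n f ≈ ∑ n (λ k → t * f k)
  *-distribˡ-∑ t zero    f = ≈-refl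
  *-distribˡ-∑ t (suc n) f = ≈-trans (distribˡ t (∑ n f) (f (suc n))) (+-congʳ (*-distribˡ-∑ t n f))

  binomial²Form-homogeneous : ∀ d t x y →
    binomial²Form d (t * x) (t * y) ≈ t ^ d * binomial²Form d x y
  binomial²Form-homogeneous d t x y = begin
    binomial²Form d (t * x) (t * y)
      ≈⟨ ∑-cong d (λ {k} k≤d → ×-congʳ (d C² k) (term k≤d)) ⟩
    ∑ d (λ k → (d C² k) × (t ^ d * (x ^ (d ∸ k) * y ^ k)))
      ≈⟨ ∑-cong d (λ {k} _ → ≈-sym (×-comm-* (d C² k) (t ^ d) _)) ⟩
    ∑ d (λ k → t ^ d * ((d C² k) × (x ^ (d ∸ k) * y ^ k)))
      ≈⟨ *-distribˡ-∑ (t ^ d) d _ ⟨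
    t ^ d * binomial²Form d x y
      ∎
    where
    term : ∀ {k} → k ≤ d → (t * x) ^ (d ∸ k) * (t * y) ^ k ≈ t ^ d * (x ^ (d ∸ k) * y ^ k)
    term {k} k≤d = begin
      (t * x) ^ (d ∸ k) * (t * y) ^ k                ≈⟨ *-cong (^-distrib-* t x (d ∸ k)) (^-distrib-* t y k) ⟩
      (t ^ (d ∸ k) * x ^ (d ∸ k)) * (t ^ k * y ^ k)  ≈⟨ *-interchange _ _ _ _ ⟩
      (t ^ (d ∸ k) * t ^ k) * (x ^ (d ∸ k) * y ^ k)  ≈⟨ *-congʳ (^-homo-* t (d ∸ k) k) ⟨
      t ^ (d ∸ k ℕ.+ k) * (x ^ (d ∸ k) * y ^ k)      ≈⟨ *-congʳ (^-congʳ t (ℕ.m∸n+n≡m k≤d)) ⟩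
      t ^ d * (x ^ (d ∸ k) * y ^ k)                  ∎

  binomial²Form-peelʳ : ∀ m x y → binomial²Form (suc m) x y ≈
    x * ∑ m (λ k → (suc m C² k) × (x ^ (m ∸ k) * y ^ k)) + y ^ suc m
  binomial²Form-peelʳ m x y = +-cong (begin
    ∑ m (λ k → (suc m C² k) × (x ^ (suc m ∸ k) * y ^ k))    ≈⟨ ∑-cong m term ⟩
    ∑ m (λ k → x * ((suc m C² k) × (x ^ (m ∸ k) * y ^ k)))  ≈⟨ *-distribˡ-∑ x m _ ⟨
    x * ∑ m (λ k → (suc m C² k) × (x ^ (m ∸ k) * y ^ k))    ∎) (begin
    (suc m C² suc m) × (x ^ (m ∸ m) * y ^ suc m)
      ≡⟨ cong₂ (λ c e → c × (x ^ e * y ^ suc m)) (cong (λ c → c ℕ.* c) (nCn≡1 (suc m))) (ℕ.n∸n≡0 m) ⟩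
    1 × (1# * y ^ suc m)  ≈⟨ ×-homo-1 _ ⟩
    1# * y ^ suc m        ≈⟨ *-identityˡ _ ⟩
    y ^ suc m             ∎)
    where
    term : ∀ {k} → k ≤ m → (suc m C² k) × (x ^ (suc m ∸ k) * y ^ k) ≈
                           x * ((suc m C² k) × (x ^ (m ∸ k) * y ^ k))
    term {k} k≤m = begin
      (suc m C² k) × (x ^ (suc m ∸ k) * y ^ k)
        ≡⟨ cong (λ e → (suc m C² k) × (x ^ e * y ^ k)) (ℕ.+-∸-assoc 1 k≤m) ⟩
      (suc m C² k) × ((x * x ^ (m ∸ k)) * y ^ k)  ≈⟨ ×-congʳ (suc m C² k) (*-assoc _ _ _) ⟩
      (suc m C² k) × (x * (x ^ (m ∸ k) * y ^ k))  ≈⟨ ×-comm-* (suc m C² k) x _ ⟨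
      x * ((suc m C² k) × (x ^ (m ∸ k) * y ^ k))  ∎

  binomial²Form-peelˡ : ∀ m x y → binomial²Form (suc m) x y ≈
    x ^ suc m + y * ∑ m (λ k → (suc m C² suc k) × (x ^ (m ∸ k) * y ^ k))
  binomial²Form-peelˡ m x y = begin
    binomial²Form (suc m) x y
      ≈⟨ ∑-unconsˡ m _ ⟩
    1 × (x ^ suc m * 1#) + ∑ m (λ k → (suc m C² suc k) × (x ^ (m ∸ k) * y ^ suc k))
      ≈⟨ +-cong (≈-trans (×-homo-1 _) (*-identityʳ _)) (∑-cong m λ {k} _ → term k) ⟩
    x ^ suc m + ∑ m (λ k → y * ((suc m C² suc k) × (x ^ (m ∸ k) * y ^ k)))
      ≈⟨ +-congˡ (*-distribˡ-∑ y m _) ⟨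
    x ^ suc m + y * ∑ m (λ k → (suc m C² suc k) × (x ^ (m ∸ k) * y ^ k))
      ∎
    where
    term : ∀ k → (suc m C² suc k) × (x ^ (m ∸ k) * (y * y ^ k)) ≈
                 y * ((suc m C² suc k) × (x ^ (m ∸ k) * y ^ k))
    term k = ≈-trans (×-congʳ (suc m C² suc k) (x*yz≈y*xz _ _ _)) (≈-sym (×-comm-* (suc m C² suc k) y _))

module Binomial²FormHomomorphism
  {a b ℓ₁ ℓ₂} (R : CommutativeSemiring a ℓ₁) (S : CommutativeSemiring b ℓ₂)
  {h : CommutativeSemiring.Carrier R → CommutativeSemiring.Carrier S}
  (isHom : IsSemiringHomomorphism (CommutativeSemiring.rawSemiring R) (CommutativeSemiring.rawSemiring S) h)
  where

  private
    module R = CommutativeSemiring R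
    module ΣR = RangeSum R.+-commutativeMonoid
    module ΣS = RangeSum (CommutativeSemiring.+-commutativeMonoid S)
    module FR = Binomial²Form R
    module FS = Binomial²Form S
    import Algebra.Properties.Semiring.Mult R.semiring as ×R
    import Algebra.Properties.Semiring.Mult (CommutativeSemiring.semiring S) as ×S
    import Algebra.Properties.Semiring.Exp R.semiring as ^R
    import Algebra.Properties.Semiring.Exp (CommutativeSemiring.semiring S) as ^S

  open CommutativeSemiring S renaming (refl to ≈-refl; trans to ≈-trans)
  open IsSemiringHomomorphism isHom

  homo-∑ : ∀ n f → h (ΣR.∑ n f) ≈ ΣS.∑ n (h ∘ f)
  homo-∑ zero    f = ≈-refl
  homo-∑ (suc n) f = ≈-trans (+-homo (ΣR.∑ n f) (f (suc n))) (+-congʳ (homo-∑ n f))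

  homo-× : ∀ n x → h (n ×R.× x) ≈ n ×S.× h x
  homo-× zero    x = 0#-homo
  homo-× (suc n) x = ≈-trans (+-homo x (n ×R.× x)) (+-congˡ (homo-× n x))

  homo-^ : ∀ x n → h (x ^R.^ n) ≈ h x ^S.^ n
  homo-^ x zero    = 1#-homo
  homo-^ x (suc n) = ≈-trans (*-homo x (x ^R.^ n)) (*-congˡ (homo-^ x n))

  binomial²Form-homo : ∀ d x y → h (FR.binomial²Form d x y) ≈ FS.binomial²Form d (h x) (h y)
  binomial²Form-homo d x y = ≈-trans (homo-∑ d _) (ΣS.∑-cong d λ {k} _ →
    ≈-trans (homo-× (d C² k) _) (×S.×-congʳ (d C² k)
      (≈-trans (*-homo _ _) (*-cong (homo-^ x (d ∸ k)) (homo-^ y k)))))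

open import Data.Integer.Base as ℤ using (ℤ; -[1+_]; ∣_∣; 0ℤ)
import Data.Integer.Coprimality as ℤ
import Data.Integer.Divisibility as ℤ
import Data.Integer.Divisibility.Signed as Signed
import Data.Integer.Properties as ℤ
import Data.Integer.Tactic.RingSolver as ℤ
open import Algebra.Properties.CommutativeSemiring.Exp ℤ.+-*-commutativeSemiring using () renaming (_^_ to _^ℤ_)
open import Data.Product using (_,_)

module ℤ-Form = Binomial²Form ℤ.+-*-commutativeSemiring

w+y*z≡0⇒y∣w : ∀ w y z → w ℤ.+ y ℤ.* z ≡ 0ℤ → y ℤ.∣ w
w+y*z≡0⇒y∣w w y z eq = Signed.∣⇒∣ᵤ (Signed.divides (ℤ.- z) (begin
  w                                    ≡⟨ lemma w y z ⟩
  (w ℤ.+ y ℤ.* z) ℤ.+ ℤ.- z ℤ.* y      ≡⟨ cong (ℤ._+ ℤ.- z ℤ.* y) eq ⟩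
  0ℤ ℤ.+ ℤ.- z ℤ.* y                   ≡⟨ ℤ.+-identityˡ _ ⟩
  ℤ.- z ℤ.* y                          ∎))
  where
  open ≡-Reasoning
  lemma : ∀ w y z → w ≡ (w ℤ.+ y ℤ.* z) ℤ.+ ℤ.- z ℤ.* y
  lemma = ℤ.solve-∀

binomial²Form≡0⇒x∣y^ : ∀ m x y → ℤ-Form.binomial²Form (suc m) x y ≡ 0ℤ → x ℤ.∣ y ^ℤ suc m
binomial²Form≡0⇒x∣y^ m x y eq = w+y*z≡0⇒y∣w (y ^ℤ suc m) x _
  (trans (ℤ.+-comm (y ^ℤ suc m) (x ℤ.* _)) (trans (sym (ℤ-Form.binomial²Form-peelʳ m x y)) eq))

binomial²Form≡0⇒y∣x^ : ∀ m x y → ℤ-Form.binomial²Form (suc m) x y ≡ 0ℤ → y ℤ.∣ x ^ℤ suc m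
binomial²Form≡0⇒y∣x^ m x y eq = w+y*z≡0⇒y∣w (x ^ℤ suc m) y _
  (trans (sym (ℤ-Form.binomial²Form-peelˡ m x y)) eq)

coprime-∣^⇒∣∣≡1 : ∀ {a b} n → ℤ.Coprime a b → a ℤ.∣ b ^ℤ n → ∣ a ∣ ≡ 1
coprime-∣^⇒∣∣≡1         zero    coprime a∣1     = ∣1⇒≡1 a∣1
coprime-∣^⇒∣∣≡1 {a} {b} (suc n) coprime a∣b^1+n =
  coprime-∣^⇒∣∣≡1 {a} {b} n coprime (ℤ.coprime-divisor a b (b ^ℤ n) coprime a∣b^1+n)

coprime-+ʳ : ∀ {a b} → ℤ.Coprime a b → ℤ.Coprime a (a ℤ.+ b)
coprime-+ʳ {a} {b} coprime {d} (d∣a , d∣a+b) = coprime (d∣a , Signed.∣⇒∣ᵤ {ℤ.+ d} {b}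
  (Signed.∣m+n∣m⇒∣n (Signed.∣ᵤ⇒∣ {ℤ.+ d} {a ℤ.+ b} d∣a+b) (Signed.∣ᵤ⇒∣ {ℤ.+ d} {a} d∣a)))

open import Algebra.Bundles using (CommutativeRing)
open import Data.Rational.Base as ℚ using (mkℚ; 1ℚ; _+_; _*_; -_; _/_; 1/_; ≢-nonZero)
import Data.Rational.Properties as ℚ
import Data.Rational.Unnormalised.Base as ℚᵘ
import Data.Rational.Unnormalised.Properties as ℚᵘ
import Data.Nat.Coprimality as ℕ
open import Data.Integer.GCD using (gcd)
open import Level using (0ℓ)
open import Relation.Nullary.Decidable.Core using (dec⇒maybe)
open import Tactic.RingSolver using (solve-∀)
open import Tactic.RingSolver.Core.AlmostCommutativeRing using (AlmostCommutativeRing; fromCommutativeRing)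

ℚ-ring : AlmostCommutativeRing 0ℓ 0ℓ
ℚ-ring = fromCommutativeRing ℚ.+-*-commutativeRing (λ x → dec⇒maybe (0ℚ ℚ.≟ x))

ℚ-commutativeSemiring : CommutativeSemiring 0ℓ 0ℓ
ℚ-commutativeSemiring = CommutativeRing.commutativeSemiring ℚ.+-*-commutativeRing

open import Algebra.Properties.CommutativeSemiring.Exp ℚ-commutativeSemiring using (_^_)

module ℚ-Form = Binomial²Form ℚ-commutativeSemiring

fromℤ : ℤ → ℚ
fromℤ i = i / 1

-- Definitionally the factor ℤ.+ k / 1 used by derivFrom.
fromℕ : ℕ → ℚ
fromℕ n = fromℤ (ℤ.+ n)

private
  toℚᵘ-fromℤ : ∀ i → ℚ.toℚᵘ (fromℤ i) ℚᵘ.≃ ℚᵘ.mkℚᵘ i 0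
  toℚᵘ-fromℤ i = ℚ.toℚᵘ-fromℚᵘ (ℚᵘ.mkℚᵘ i 0)

fromℤ-+ : ∀ i j → fromℤ (i ℤ.+ j) ≡ fromℤ i + fromℤ j
fromℤ-+ i j = ℚ.toℚᵘ-injective (begin
  ℚ.toℚᵘ (fromℤ (i ℤ.+ j))                    ≈⟨ toℚᵘ-fromℤ (i ℤ.+ j) ⟩
  ℚᵘ.mkℚᵘ (i ℤ.+ j) 0                         ≈⟨ ℚᵘ.*≡* (lemma i j) ⟩
  ℚᵘ.mkℚᵘ i 0 ℚᵘ.+ ℚᵘ.mkℚᵘ j 0               ≈⟨ ℚᵘ.+-cong (toℚᵘ-fromℤ i) (toℚᵘ-fromℤ j) ⟨
  ℚ.toℚᵘ (fromℤ i) ℚᵘ.+ ℚ.toℚᵘ (fromℤ j)      ≈⟨ ℚ.toℚᵘ-homo-+ (fromℤ i) (fromℤ j) ⟨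
  ℚ.toℚᵘ (fromℤ i + fromℤ j)                  ∎)
  where
  open ℚᵘ.≃-Reasoning
  lemma : ∀ i j → (i ℤ.+ j) ℤ.* ℤ.+ 1 ≡ (i ℤ.* ℤ.+ 1 ℤ.+ j ℤ.* ℤ.+ 1) ℤ.* ℤ.+ 1
  lemma = ℤ.solve-∀

fromℤ-* : ∀ i j → fromℤ (i ℤ.* j) ≡ fromℤ i * fromℤ j
fromℤ-* i j = ℚ.toℚᵘ-injective (begin
  ℚ.toℚᵘ (fromℤ (i ℤ.* j))                    ≈⟨ toℚᵘ-fromℤ (i ℤ.* j) ⟩
  ℚᵘ.mkℚᵘ (i ℤ.* j) 0                         ≈⟨ ℚᵘ.*≡* refl ⟩
  ℚᵘ.mkℚᵘ i 0 ℚᵘ.* ℚᵘ.mkℚᵘ j 0               ≈⟨ ℚᵘ.*-cong (toℚᵘ-fromℤ i) (toℚᵘ-fromℤ j) ⟨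
  ℚ.toℚᵘ (fromℤ i) ℚᵘ.* ℚ.toℚᵘ (fromℤ j)      ≈⟨ ℚ.toℚᵘ-homo-* (fromℤ i) (fromℤ j) ⟨
  ℚ.toℚᵘ (fromℤ i * fromℤ j)                  ∎)
  where open ℚᵘ.≃-Reasoning

fromℤ-injective : ∀ {i j} → fromℤ i ≡ fromℤ j → i ≡ j
fromℤ-injective {i} {j} eq with ℚᵘ.≃-trans (ℚᵘ.≃-sym (toℚᵘ-fromℤ i))
                                  (ℚᵘ.≃-trans (ℚ.toℚᵘ-cong eq) (toℚᵘ-fromℤ j))
... | ℚᵘ.*≡* i*1≡j*1 = trans (sym (ℤ.*-identityʳ i)) (trans i*1≡j*1 (ℤ.*-identityʳ j))

fromℤ-isSemiringHomomorphism : IsSemiringHomomorphism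
  (CommutativeSemiring.rawSemiring ℤ.+-*-commutativeSemiring)
  (CommutativeSemiring.rawSemiring ℚ-commutativeSemiring) fromℤ
fromℤ-isSemiringHomomorphism = record
  { isNearSemiringHomomorphism = record
    { +-isMonoidHomomorphism = record
      { isMagmaHomomorphism = record
        { isRelHomomorphism = record { cong = cong fromℤ }
        ; homo = fromℤ-+
        }
      ; ε-homo = refl
      }
    ; *-homo = fromℤ-*
    }
  ; 1#-homo = refl
  }

module fromℤ-homo = Binomial²FormHomomorphism ℤ.+-*-commutativeSemiring ℚ-commutativeSemiring
                      fromℤ-isSemiringHomomorphism

fromℕ-suc : ∀ n → fromℕ (suc n) ≡ 1ℚ + fromℕ n
fromℕ-suc n = fromℤ-+ (ℤ.+ 1) (ℤ.+ n)

fromℕ-* : ∀ m n → fromℕ (m ℕ.* n) ≡ fromℕ m * fromℕ n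
fromℕ-* m n = trans (cong fromℤ (ℤ.pos-* m n)) (fromℤ-* (ℤ.+ m) (ℤ.+ n))

fromℕ≢0 : ∀ n .{{_ : ℕ.NonZero n}} → fromℕ n ≢ 0ℚ
fromℕ≢0 (suc n) eq with fromℤ-injective {ℤ.+ suc n} {0ℤ} eq
... | ()

*-cancelˡ-≡0 : ∀ {p q} → p ≢ 0ℚ → p * q ≡ 0ℚ → q ≡ 0ℚ
*-cancelˡ-≡0 {p} {q} p≢0 pq≡0 = begin
  q                 ≡⟨ ℚ.*-identityˡ q ⟨
  1ℚ * q            ≡⟨ cong (_* q) (ℚ.*-inverseˡ p) ⟨
  (1/ p * p) * q    ≡⟨ ℚ.*-assoc (1/ p) p q ⟩
  1/ p * (p * q)    ≡⟨ cong (1/ p *_) pq≡0 ⟩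
  1/ p * 0ℚ         ≡⟨ ℚ.*-zeroʳ (1/ p) ⟩
  0ℚ                ∎
  where
  open ≡-Reasoning
  instance _ = ≢-nonZero p≢0

*-≢0 : ∀ {p q} → p ≢ 0ℚ → q ≢ 0ℚ → p * q ≢ 0ℚ
*-≢0 p≢0 q≢0 pq≡0 = q≢0 (*-cancelˡ-≡0 p≢0 pq≡0)

^-≢0 : ∀ {p} → p ≢ 0ℚ → ∀ n → p ^ n ≢ 0ℚ
^-≢0 p≢0 zero    ()
^-≢0 p≢0 (suc n) = *-≢0 p≢0 (^-≢0 p≢0 n)

-- mkℚ a c _ stands for a / (c + 1).
fromℕ[1+c]*mkℚ≡fromℤ : ∀ a c .(cop : ℕ.Coprime ∣ a ∣ (suc c)) → fromℕ (suc c) * mkℚ a c cop ≡ fromℤ a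
fromℕ[1+c]*mkℚ≡fromℤ a c cop = ℚ.toℚᵘ-injective (begin
  ℚ.toℚᵘ (fromℕ (suc c) * mkℚ a c cop)            ≈⟨ ℚ.toℚᵘ-homo-* (fromℕ (suc c)) (mkℚ a c cop) ⟩
  ℚ.toℚᵘ (fromℕ (suc c)) ℚᵘ.* ℚᵘ.mkℚᵘ a c        ≈⟨ ℚᵘ.*-congʳ (toℚᵘ-fromℤ (ℤ.+ suc c)) ⟩
  ℚᵘ.mkℚᵘ (ℤ.+ suc c) 0 ℚᵘ.* ℚᵘ.mkℚᵘ a c         ≈⟨ ℚᵘ.*≡* (lemma a c) ⟩
  ℚᵘ.mkℚᵘ a 0                                    ≈⟨ toℚᵘ-fromℤ a ⟨
  ℚ.toℚᵘ (fromℤ a)                               ∎)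
  where
  open ℚᵘ.≃-Reasoning
  lemma : ∀ a c → (ℤ.+ suc c ℤ.* a) ℤ.* ℤ.+ 1 ≡ a ℤ.* ℤ.+ (1 ℕ.* suc c)
  lemma a c = trans (ℤ.*-identityʳ _)
    (trans (ℤ.*-comm (ℤ.+ suc c) a) (cong (λ n → a ℤ.* ℤ.+ n) (sym (ℕ.*-identityˡ (suc c)))))

mkℚ≡-½ : ∀ a c .(cop : ℕ.Coprime ∣ a ∣ (suc c)) → ∣ a ∣ ≡ 1 → ∣ a ℤ.+ ℤ.+ suc c ∣ ≡ 1 → mkℚ a c cop ≡ ℚ.-½
mkℚ≡-½ (ℤ.+ 1)   c  _ refl ()
mkℚ≡-½ -[1+ 0 ] .1  _ refl refl = refl

binomial²Form[u,u+1]≡0⇒u≡-½ : ∀ m u → ℚ-Form.binomial²Form (suc m) u (u + 1ℚ) ≡ 0ℚ → u ≡ ℚ.-½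
binomial²Form[u,u+1]≡0⇒u≡-½ m u@(mkℚ a c cop) root = mkℚ≡-½ a c cop
  (coprime-∣^⇒∣∣≡1 {a} {b} (suc m) coprime (binomial²Form≡0⇒x∣y^ m a b integer-root))
  (coprime-∣^⇒∣∣≡1 {b} {a} (suc m) (ℤ.sym {a} {b} coprime) (binomial²Form≡0⇒y∣x^ m a b integer-root))
  where
  b = a ℤ.+ ℤ.+ suc c
  n = fromℕ (suc c)
  coprime : ℤ.Coprime a b
  coprime = coprime-+ʳ {a} {ℤ.+ suc c} (ℕ.recompute cop)
  nu≡a : n * u ≡ fromℤ a
  nu≡a = fromℕ[1+c]*mkℚ≡fromℤ a c cop
  n[u+1]≡b : n * (u + 1ℚ) ≡ fromℤ b
  n[u+1]≡b = begin
    n * (u + 1ℚ)    ≡⟨ ℚ.*-distribˡ-+ n u 1ℚ ⟩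
    n * u + n * 1ℚ  ≡⟨ cong₂ _+_ nu≡a (ℚ.*-identityʳ n) ⟩
    fromℤ a + n     ≡⟨ fromℤ-+ a (ℤ.+ suc c) ⟨
    fromℤ b         ∎
    where open ≡-Reasoning
  integer-root : ℤ-Form.binomial²Form (suc m) a b ≡ 0ℤ
  integer-root = fromℤ-injective (begin
    fromℤ (ℤ-Form.binomial²Form (suc m) a b)
      ≡⟨ fromℤ-homo.binomial²Form-homo (suc m) a b ⟩
    ℚ-Form.binomial²Form (suc m) (fromℤ a) (fromℤ b)
      ≡⟨ cong₂ (ℚ-Form.binomial²Form (suc m)) nu≡a n[u+1]≡b ⟨
    ℚ-Form.binomial²Form (suc m) (n * u) (n * (u + 1ℚ))
      ≡⟨ ℚ-Form.binomial²Form-homogeneous (suc m) n u (u + 1ℚ) ⟩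
    n ^ suc m * ℚ-Form.binomial²Form (suc m) u (u + 1ℚ)
      ≡⟨ cong (n ^ suc m *_) root ⟩
    n ^ suc m * 0ℚ
      ≡⟨ ℚ.*-zeroʳ (n ^ suc m) ⟩
    0ℚ
      ∎)
    where open ≡-Reasoning

-- Polynomials

open import Algebra.Structures.Biased using (isCommutativeSemiringˡ)
open import Data.List.Base using ([]; _∷_)
open import Relation.Binary.Bundles using (Setoid)
open import Relation.Binary.Structures using (IsEquivalence)

coeff : Poly → ℕ → ℚ
coeff []      i       = 0ℚ
coeff (a ∷ p) zero    = a
coeff (a ∷ p) (suc i) = coeff p i

-- Trailing zeros make the list representation non-canonical, so polynomials are compared coefficientwise.
infix 4 _≈ₚ_
record _≈ₚ_ (p q : Poly) : Set where
  constructor coeffwise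
  field coeff-≡ : ∀ i → coeff p i ≡ coeff q i
open _≈ₚ_ public

≈ₚ-isEquivalence : IsEquivalence _≈ₚ_
≈ₚ-isEquivalence = record
  { refl  = coeffwise λ i → refl
  ; sym   = λ p≈q → coeffwise λ i → sym (coeff-≡ p≈q i)
  ; trans = λ p≈q q≈r → coeffwise λ i → trans (coeff-≡ p≈q i) (coeff-≡ q≈r i)
  }

≈ₚ-setoid : Setoid 0ℓ 0ℓ
≈ₚ-setoid = record { isEquivalence = ≈ₚ-isEquivalence }

open Setoid ≈ₚ-setoid using () renaming (refl to ≈ₚ-refl; sym to ≈ₚ-sym; trans to ≈ₚ-trans; reflexive to ≈ₚ-reflexive)
import Relation.Binary.Reasoning.Setoid ≈ₚ-setoid as ≈ₚ-Reasoning

∷-cong : ∀ {a b p q} → a ≡ b → p ≈ₚ q → a ∷ p ≈ₚ b ∷ q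
∷-cong a≡b p≈q = coeffwise λ { zero → a≡b ; (suc i) → coeff-≡ p≈q i }

∷-≈[] : ∀ {a p} → a ≡ 0ℚ → p ≈ₚ [] → a ∷ p ≈ₚ []
∷-≈[] a≡0 p≈[] = coeffwise λ { zero → a≡0 ; (suc i) → coeff-≡ p≈[] i }

coeff-⊕ : ∀ p q i → coeff (p ⊕ q) i ≡ coeff p i + coeff q i
coeff-⊕ []      q       i       = sym (ℚ.+-identityˡ (coeff q i))
coeff-⊕ (a ∷ p) []      i       = sym (ℚ.+-identityʳ (coeff (a ∷ p) i))
coeff-⊕ (a ∷ p) (b ∷ q) zero    = refl
coeff-⊕ (a ∷ p) (b ∷ q) (suc i) = coeff-⊕ p q i

coeff-· : ∀ c p i → coeff (c · p) i ≡ c * coeff p i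
coeff-· c []      i       = sym (ℚ.*-zeroʳ c)
coeff-· c (a ∷ p) zero    = refl
coeff-· c (a ∷ p) (suc i) = coeff-· c p i

⊕-cong : ∀ {p p′ q q′} → p ≈ₚ p′ → q ≈ₚ q′ → p ⊕ q ≈ₚ p′ ⊕ q′
⊕-cong {p} {p′} {q} {q′} p≈p′ q≈q′ = coeffwise λ i → trans (coeff-⊕ p q i)
  (trans (cong₂ _+_ (coeff-≡ p≈p′ i) (coeff-≡ q≈q′ i)) (sym (coeff-⊕ p′ q′ i)))

⊕-congˡ : ∀ p {q q′} → q ≈ₚ q′ → p ⊕ q ≈ₚ p ⊕ q′
⊕-congˡ p = ⊕-cong (≈ₚ-refl {p})

·-congˡ : ∀ c {p q} → p ≈ₚ q → c · p ≈ₚ c · q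
·-congˡ c {p} {q} p≈q = coeffwise λ i → trans (coeff-· c p i)
  (trans (cong (c *_) (coeff-≡ p≈q i)) (sym (coeff-· c q i)))

⊕-identityʳ : ∀ p → p ⊕ [] ≡ p
⊕-identityʳ []      = refl
⊕-identityʳ (a ∷ p) = refl

⊕-comm : ∀ p q → p ⊕ q ≡ q ⊕ p
⊕-comm []      q       = sym (⊕-identityʳ q)
⊕-comm (a ∷ p) []      = refl
⊕-comm (a ∷ p) (b ∷ q) = cong₂ _∷_ (ℚ.+-comm a b) (⊕-comm p q)

⊕-assoc : ∀ p q r → (p ⊕ q) ⊕ r ≡ p ⊕ (q ⊕ r)
⊕-assoc []      q       r       = refl
⊕-assoc (a ∷ p) []      r       = refl
⊕-assoc (a ∷ p) (b ∷ q) []      = refl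
⊕-assoc (a ∷ p) (b ∷ q) (c ∷ r) = cong₂ _∷_ (ℚ.+-assoc a b c) (⊕-assoc p q r)

⊕-commutativeMonoid : CommutativeMonoid 0ℓ 0ℓ
⊕-commutativeMonoid = record
  { Carrier = Poly
  ; _≈_ = _≈ₚ_
  ; _∙_ = _⊕_
  ; ε = []
  ; isCommutativeMonoid = record
    { isMonoid = record
      { isSemigroup = record
        { isMagma = record { isEquivalence = ≈ₚ-isEquivalence ; ∙-cong = ⊕-cong }
        ; assoc = λ p q r → ≈ₚ-reflexive (⊕-assoc p q r)
        }
      ; identity = (λ p → ≈ₚ-refl) , (λ p → ≈ₚ-reflexive (⊕-identityʳ p))
      }
    ; comm = λ p q → ≈ₚ-reflexive (⊕-comm p q)
    }
  }

·-distribˡ : ∀ c p q → c · (p ⊕ q) ≡ c · p ⊕ c · q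
·-distribˡ c []      q       = refl
·-distribˡ c (a ∷ p) []      = refl
·-distribˡ c (a ∷ p) (b ∷ q) = cong₂ _∷_ (ℚ.*-distribˡ-+ c a b) (·-distribˡ c p q)

·-distribʳ : ∀ c d p → (c + d) · p ≡ c · p ⊕ d · p
·-distribʳ c d []      = refl
·-distribʳ c d (a ∷ p) = cong₂ _∷_ (ℚ.*-distribʳ-+ a c d) (·-distribʳ c d p)

·-assoc : ∀ c d p → c · (d · p) ≡ (c * d) · p
·-assoc c d []      = refl
·-assoc c d (a ∷ p) = cong₂ _∷_ (sym (ℚ.*-assoc c d a)) (·-assoc c d p)

·-identityˡ : ∀ p → 1ℚ · p ≡ p
·-identityˡ []      = refl
·-identityˡ (a ∷ p) = cong₂ _∷_ (ℚ.*-identityˡ a) (·-identityˡ p)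

·-zeroˡ : ∀ p → 0ℚ · p ≈ₚ []
·-zeroˡ []      = ≈ₚ-refl
·-zeroˡ (a ∷ p) = ∷-≈[] (ℚ.*-zeroˡ a) (·-zeroˡ p)

≈[]-⊛ : ∀ {p} r → p ≈ₚ [] → p ⊛ r ≈ₚ []
≈[]-⊛ {[]}    r p≈[] = ≈ₚ-refl
≈[]-⊛ {a ∷ p} r p≈[] = begin
  a · r ⊕ (0ℚ ∷ (p ⊛ r))   ≈⟨ ⊕-cong (≈ₚ-reflexive (cong (_· r) (coeff-≡ p≈[] 0))) (∷-cong refl tail) ⟩
  0ℚ · r ⊕ (0ℚ ∷ [])       ≈⟨ ⊕-cong (·-zeroˡ r) (∷-≈[] refl ≈ₚ-refl) ⟩
  []                       ∎
  where
  open ≈ₚ-Reasoning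
  tail : p ⊛ r ≈ₚ []
  tail = ≈[]-⊛ {p} r (coeffwise (coeff-≡ p≈[] ∘ suc))

⊛-zeroʳ : ∀ p → p ⊛ [] ≈ₚ []
⊛-zeroʳ []      = ≈ₚ-refl
⊛-zeroʳ (a ∷ p) = ∷-≈[] refl (⊛-zeroʳ p)

⊛-congˡ : ∀ {p q} r → p ≈ₚ q → p ⊛ r ≈ₚ q ⊛ r
⊛-congˡ {[]}    {[]}    r p≈q = ≈ₚ-refl
⊛-congˡ {a ∷ p} {[]}    r p≈q = ≈[]-⊛ r p≈q
⊛-congˡ {[]}    {b ∷ q} r p≈q = ≈ₚ-sym (≈[]-⊛ r (≈ₚ-sym p≈q))
⊛-congˡ {a ∷ p} {b ∷ q} r p≈q = ⊕-cong (≈ₚ-reflexive (cong (_· r) (coeff-≡ p≈q 0)))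
  (∷-cong refl (⊛-congˡ {p} {q} r (coeffwise (coeff-≡ p≈q ∘ suc))))

⊛-congʳ : ∀ p {q r} → q ≈ₚ r → p ⊛ q ≈ₚ p ⊛ r
⊛-congʳ []      q≈r = ≈ₚ-refl
⊛-congʳ (a ∷ p) q≈r = ⊕-cong (·-congˡ a q≈r) (∷-cong refl (⊛-congʳ p q≈r))

⊛-cong : ∀ {p p′ q q′} → p ≈ₚ p′ → q ≈ₚ q′ → p ⊛ q ≈ₚ p′ ⊛ q′
⊛-cong {p′ = p′} {q} p≈p′ q≈q′ = ≈ₚ-trans (⊛-congˡ q p≈p′) (⊛-congʳ p′ q≈q′)

0∷-⊛ : ∀ p r → (0ℚ ∷ p) ⊛ r ≈ₚ 0ℚ ∷ (p ⊛ r)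
0∷-⊛ p r = ⊕-cong (·-zeroˡ r) ≈ₚ-refl

·-⊛ : ∀ c p q → (c · p) ⊛ q ≈ₚ c · (p ⊛ q)
·-⊛ c []      q = ≈ₚ-refl
·-⊛ c (a ∷ p) q = begin
  (c * a) · q ⊕ (0ℚ ∷ ((c · p) ⊛ q))      ≈⟨ ⊕-cong (≈ₚ-reflexive (sym (·-assoc c a q)))
                                                    (∷-cong (sym (ℚ.*-zeroʳ c)) (·-⊛ c p q)) ⟩
  c · (a · q) ⊕ c · (0ℚ ∷ (p ⊛ q))        ≡⟨ ·-distribˡ c (a · q) (0ℚ ∷ (p ⊛ q)) ⟨
  c · ((a ∷ p) ⊛ q)                       ∎
  where open ≈ₚ-Reasoning

⊛-distribʳ : ∀ p q r → (p ⊕ q) ⊛ r ≈ₚ p ⊛ r ⊕ q ⊛ r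
⊛-distribʳ []      q       r = ≈ₚ-refl
⊛-distribʳ (a ∷ p) []      r = ≈ₚ-reflexive (sym (⊕-identityʳ _))
⊛-distribʳ (a ∷ p) (b ∷ q) r = begin
  (a + b) · r ⊕ (0ℚ ∷ ((p ⊕ q) ⊛ r))
    ≈⟨ ⊕-cong (≈ₚ-reflexive (·-distribʳ a b r)) (∷-cong refl (⊛-distribʳ p q r)) ⟩
  (a · r ⊕ b · r) ⊕ ((0ℚ ∷ (p ⊛ r)) ⊕ (0ℚ ∷ (q ⊛ r)))
    ≈⟨ interchange (a · r) (b · r) (0ℚ ∷ (p ⊛ r)) (0ℚ ∷ (q ⊛ r)) ⟩
  (a ∷ p) ⊛ r ⊕ (b ∷ q) ⊛ r
    ∎
  where
  open ≈ₚ-Reasoning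
  open import Algebra.Properties.CommutativeSemigroup
    (CommutativeMonoid.commutativeSemigroup ⊕-commutativeMonoid) using (interchange)

⊛-assoc : ∀ p q r → (p ⊛ q) ⊛ r ≈ₚ p ⊛ (q ⊛ r)
⊛-assoc []      q r = ≈ₚ-refl
⊛-assoc (a ∷ p) q r = begin
  (a · q ⊕ (0ℚ ∷ (p ⊛ q))) ⊛ r        ≈⟨ ⊛-distribʳ (a · q) (0ℚ ∷ (p ⊛ q)) r ⟩
  (a · q) ⊛ r ⊕ (0ℚ ∷ (p ⊛ q)) ⊛ r    ≈⟨ ⊕-cong (·-⊛ a q r) (0∷-⊛ (p ⊛ q) r) ⟩
  a · (q ⊛ r) ⊕ (0ℚ ∷ ((p ⊛ q) ⊛ r))  ≈⟨ ⊕-congˡ (a · (q ⊛ r)) (∷-cong refl (⊛-assoc p q r)) ⟩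
  (a ∷ p) ⊛ (q ⊛ r)                   ∎
  where open ≈ₚ-Reasoning

⊛-consʳ : ∀ p b q → p ⊛ (b ∷ q) ≈ₚ b · p ⊕ (0ℚ ∷ (p ⊛ q))
⊛-consʳ []      b q = ≈ₚ-sym (∷-≈[] refl ≈ₚ-refl)
⊛-consʳ (a ∷ p) b q = ∷-cong (cong (_+ 0ℚ) (ℚ.*-comm a b)) (begin
  a · q ⊕ p ⊛ (b ∷ q)               ≈⟨ ⊕-congˡ (a · q) (⊛-consʳ p b q) ⟩
  a · q ⊕ (b · p ⊕ (0ℚ ∷ (p ⊛ q)))  ≈⟨ x∙yz≈y∙xz (a · q) (b · p) _ ⟩
  b · p ⊕ (a · q ⊕ (0ℚ ∷ (p ⊛ q)))  ∎)
  where
  open ≈ₚ-Reasoning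
  open import Algebra.Properties.CommutativeSemigroup
    (CommutativeMonoid.commutativeSemigroup ⊕-commutativeMonoid) using (x∙yz≈y∙xz)

⊛-comm : ∀ p q → p ⊛ q ≈ₚ q ⊛ p
⊛-comm []      q = ≈ₚ-sym (⊛-zeroʳ q)
⊛-comm (a ∷ p) q = begin
  a · q ⊕ (0ℚ ∷ (p ⊛ q))  ≈⟨ ⊕-congˡ (a · q) (∷-cong refl (⊛-comm p q)) ⟩
  a · q ⊕ (0ℚ ∷ (q ⊛ p))  ≈⟨ ⊛-consʳ q a p ⟨
  q ⊛ (a ∷ p)             ∎
  where open ≈ₚ-Reasoning

⊛-identityˡ : ∀ p → (1ℚ ∷ []) ⊛ p ≈ₚ p
⊛-identityˡ p = begin
  1ℚ · p ⊕ (0ℚ ∷ [])  ≈⟨ ⊕-cong (≈ₚ-reflexive (·-identityˡ p)) (∷-≈[] refl ≈ₚ-refl) ⟩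
  p ⊕ []              ≡⟨ ⊕-identityʳ p ⟩
  p                   ∎
  where open ≈ₚ-Reasoning

ℚ[X] : CommutativeSemiring 0ℓ 0ℓ
ℚ[X] = record
  { Carrier = Poly
  ; _≈_ = _≈ₚ_
  ; _+_ = _⊕_
  ; _*_ = _⊛_
  ; 0# = []
  ; 1# = 1ℚ ∷ []
  ; isCommutativeSemiring = isCommutativeSemiringˡ record
    { +-isCommutativeMonoid = CommutativeMonoid.isCommutativeMonoid ⊕-commutativeMonoid
    ; *-isCommutativeMonoid = record
      { isMonoid = record
        { isSemigroup = record
          { isMagma = record { isEquivalence = ≈ₚ-isEquivalence ; ∙-cong = ⊛-cong }
          ; assoc = ⊛-assoc
          }
        ; identity = ⊛-identityˡ , λ p → ≈ₚ-trans (⊛-comm p _) (⊛-identityˡ p)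
        }
      ; comm = ⊛-comm
      }
    ; distribʳ = λ r p q → ⊛-distribʳ p q r
    ; zeroˡ = λ p → ≈ₚ-refl
    }
  }

-- Derivatives

coeff-derivFrom : ∀ k p i → coeff (derivFrom k p) i ≡ fromℕ (k ℕ.+ i) * coeff p i
coeff-derivFrom k []      i       = sym (ℚ.*-zeroʳ (fromℕ (k ℕ.+ i)))
coeff-derivFrom k (a ∷ p) zero    = cong (λ m → fromℕ m * a) (sym (ℕ.+-identityʳ k))
coeff-derivFrom k (a ∷ p) (suc i) = trans (coeff-derivFrom (suc k) p i)
  (cong (λ m → fromℕ m * coeff p i) (sym (ℕ.+-suc k i)))

coeff-deriv : ∀ p i → coeff (deriv p) i ≡ fromℕ (suc i) * coeff p (suc i)
coeff-deriv []      i = sym (ℚ.*-zeroʳ (fromℕ (suc i)))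
coeff-deriv (a ∷ p) i = coeff-derivFrom 1 p i

deriv-cong : ∀ {p q} → p ≈ₚ q → deriv p ≈ₚ deriv q
deriv-cong {p} {q} p≈q = coeffwise λ i → trans (coeff-deriv p i)
  (trans (cong (fromℕ (suc i) *_) (coeff-≡ p≈q (suc i))) (sym (coeff-deriv q i)))

derivFrom-⊕ : ∀ k p q → derivFrom k (p ⊕ q) ≡ derivFrom k p ⊕ derivFrom k q
derivFrom-⊕ k []      q       = refl
derivFrom-⊕ k (a ∷ p) []      = refl
derivFrom-⊕ k (a ∷ p) (b ∷ q) = cong₂ _∷_ (ℚ.*-distribˡ-+ (fromℕ k) a b) (derivFrom-⊕ (suc k) p q)

deriv-⊕ : ∀ p q → deriv (p ⊕ q) ≡ deriv p ⊕ deriv q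
deriv-⊕ []      q       = refl
deriv-⊕ (a ∷ p) []      = sym (⊕-identityʳ (deriv (a ∷ p)))
deriv-⊕ (a ∷ p) (b ∷ q) = derivFrom-⊕ 1 p q

derivFrom-· : ∀ k c p → derivFrom k (c · p) ≡ c · derivFrom k p
derivFrom-· k c []      = refl
derivFrom-· k c (a ∷ p) = cong₂ _∷_ (x*yz≈y*xz (fromℕ k) c a) (derivFrom-· (suc k) c p)
  where open import Algebra.Properties.CommutativeSemigroup (CommutativeMonoid.commutativeSemigroup ℚ.*-1-commutativeMonoid)
          using () renaming (x∙yz≈y∙xz to x*yz≈y*xz)

deriv-· : ∀ c p → deriv (c · p) ≡ c · deriv p
deriv-· c []      = refl
deriv-· c (a ∷ p) = derivFrom-· 1 c p

derivFrom-suc : ∀ k p → derivFrom (suc k) p ≡ p ⊕ derivFrom k p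
derivFrom-suc k []      = refl
derivFrom-suc k (a ∷ p) = cong₂ _∷_ head (derivFrom-suc (suc k) p)
  where
  head : fromℕ (suc k) * a ≡ a + fromℕ k * a
  head = trans (cong (_* a) (fromℕ-suc k))
    (trans (ℚ.*-distribʳ-+ a 1ℚ (fromℕ k)) (cong (_+ fromℕ k * a) (ℚ.*-identityˡ a)))

derivFrom-zero : ∀ p → derivFrom 0 p ≈ₚ 0ℚ ∷ deriv p
derivFrom-zero []      = ≈ₚ-sym (∷-≈[] refl ≈ₚ-refl)
derivFrom-zero (a ∷ p) = ∷-cong (ℚ.*-zeroˡ a) ≈ₚ-refl

deriv-∷ : ∀ a p → deriv (a ∷ p) ≈ₚ p ⊕ (0ℚ ∷ deriv p)
deriv-∷ a p = begin
  derivFrom 1 p          ≡⟨ derivFrom-suc 0 p ⟩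
  p ⊕ derivFrom 0 p      ≈⟨ ⊕-congˡ p (derivFrom-zero p) ⟩
  p ⊕ (0ℚ ∷ deriv p)     ∎
  where open ≈ₚ-Reasoning

deriv-⊛ : ∀ p q → deriv (p ⊛ q) ≈ₚ deriv p ⊛ q ⊕ p ⊛ deriv q
deriv-⊛ []      q = ≈ₚ-refl
deriv-⊛ (a ∷ p) q = begin
  deriv (a · q ⊕ (0ℚ ∷ (p ⊛ q)))
    ≡⟨ deriv-⊕ (a · q) (0ℚ ∷ (p ⊛ q)) ⟩
  deriv (a · q) ⊕ deriv (0ℚ ∷ (p ⊛ q))
    ≈⟨ ⊕-cong (≈ₚ-reflexive (deriv-· a q)) (deriv-∷ 0ℚ (p ⊛ q)) ⟩
  a · q′ ⊕ (p ⊛ q ⊕ (0ℚ ∷ deriv (p ⊛ q)))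
    ≈⟨ ⊕-congˡ (a · q′) (⊕-congˡ (p ⊛ q) (∷-cong (sym (ℚ.+-identityʳ 0ℚ)) (deriv-⊛ p q))) ⟩
  a · q′ ⊕ (p ⊛ q ⊕ ((0ℚ ∷ (p′ ⊛ q)) ⊕ (0ℚ ∷ (p ⊛ q′))))
    ≈⟨ solve 4 (λ w x y z → w ⊕′ (x ⊕′ (y ⊕′ z)) ⊜ (x ⊕′ y) ⊕′ (w ⊕′ z)) ≈ₚ-refl
         (a · q′) (p ⊛ q) (0ℚ ∷ (p′ ⊛ q)) (0ℚ ∷ (p ⊛ q′)) ⟩
  (p ⊛ q ⊕ (0ℚ ∷ (p′ ⊛ q))) ⊕ (a ∷ p) ⊛ q′
    ≈⟨ ⊕-cong (⊕-congˡ (p ⊛ q) (0∷-⊛ p′ q)) ≈ₚ-refl ⟨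
  (p ⊛ q ⊕ (0ℚ ∷ p′) ⊛ q) ⊕ (a ∷ p) ⊛ q′
    ≈⟨ ⊕-cong (⊛-distribʳ p (0ℚ ∷ p′) q) ≈ₚ-refl ⟨
  (p ⊕ (0ℚ ∷ p′)) ⊛ q ⊕ (a ∷ p) ⊛ q′
    ≈⟨ ⊕-cong (⊛-congˡ q (deriv-∷ a p)) ≈ₚ-refl ⟨
  deriv (a ∷ p) ⊛ q ⊕ (a ∷ p) ⊛ q′
    ∎
  where
  open ≈ₚ-Reasoning
  open import Algebra.Solver.CommutativeMonoid ⊕-commutativeMonoid
    using (solve; _⊜_) renaming (_⊕_ to _⊕′_)
  p′ = deriv p
  q′ = deriv q

import Algebra.Properties.CommutativeSemiring.Exp ℚ[X] as ℚ[X]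
open import Algebra.Properties.Semiring.Mult (CommutativeSemiring.semiring ℚ[X])
  using (×-comm-*; ×-congʳ; ×-assocˡ; ×-assoc-*) renaming (_×_ to _×ₚ_)
open RangeSum ⊕-commutativeMonoid using (∑; ∑-cong; ∑-pascal; ×-distrib-∑)
module ℚ[X]-Form = Binomial²Form ℚ[X]

^ₚ≡^ : ∀ p n → p ^ₚ n ≡ p ℚ[X].^ n
^ₚ≡^ p zero    = refl
^ₚ≡^ p (suc n) = cong (p ⊛_) (^ₚ≡^ p n)

derivⁿ-cong : ∀ n {p q} → p ≈ₚ q → derivⁿ n p ≈ₚ derivⁿ n q
derivⁿ-cong zero    p≈q = p≈q
derivⁿ-cong (suc n) p≈q = deriv-cong (derivⁿ-cong n p≈q)

derivⁿ-⊕ : ∀ n p q → derivⁿ n (p ⊕ q) ≡ derivⁿ n p ⊕ derivⁿ n q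
derivⁿ-⊕ zero    p q = refl
derivⁿ-⊕ (suc n) p q = trans (cong deriv (derivⁿ-⊕ n p q)) (deriv-⊕ (derivⁿ n p) (derivⁿ n q))

derivⁿ-sucʳ : ∀ n p → derivⁿ (suc n) p ≡ derivⁿ n (deriv p)
derivⁿ-sucʳ zero    p = refl
derivⁿ-sucʳ (suc n) p = cong deriv (derivⁿ-sucʳ n p)

coeff₀-derivⁿ : ∀ n p → coeff (derivⁿ n p) 0 ≡ fromℕ (n !) * coeff p n
coeff₀-derivⁿ zero    p = sym (ℚ.*-identityˡ (coeff p 0))
coeff₀-derivⁿ (suc n) p = begin
  coeff (derivⁿ (suc n) p) 0
    ≡⟨ cong (λ q → coeff q 0) (derivⁿ-sucʳ n p) ⟩
  coeff (derivⁿ n (deriv p)) 0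
    ≡⟨ coeff₀-derivⁿ n (deriv p) ⟩
  fromℕ (n !) * coeff (deriv p) n
    ≡⟨ cong (fromℕ (n !) *_) (coeff-deriv p n) ⟩
  fromℕ (n !) * (fromℕ (suc n) * coeff p (suc n))
    ≡⟨ lemma (fromℕ (n !)) (fromℕ (suc n)) (coeff p (suc n)) ⟩
  (fromℕ (suc n) * fromℕ (n !)) * coeff p (suc n)
    ≡⟨ cong (_* coeff p (suc n)) (fromℕ-* (suc n) (n !)) ⟨
  fromℕ (suc n !) * coeff p (suc n)
    ∎
  where
  open ≡-Reasoning
  lemma : ∀ a b c → a * (b * c) ≡ (b * a) * c
  lemma = solve-∀ ℚ-ring

derivⁿ-⊛ : ∀ n f g → derivⁿ n (f ⊛ g) ≈ₚ ∑ n (λ k → (n C k) ×ₚ (derivⁿ k f ⊛ derivⁿ (n ∸ k) g))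
derivⁿ-⊛ zero    f g = ≈ₚ-reflexive (sym (⊕-identityʳ (f ⊛ g)))
derivⁿ-⊛ (suc n) f g = begin
  derivⁿ (suc n) (f ⊛ g)
    ≡⟨ derivⁿ-sucʳ n (f ⊛ g) ⟩
  derivⁿ n (deriv (f ⊛ g))
    ≈⟨ derivⁿ-cong n (deriv-⊛ f g) ⟩
  derivⁿ n (deriv f ⊛ g ⊕ f ⊛ deriv g)
    ≡⟨ derivⁿ-⊕ n (deriv f ⊛ g) (f ⊛ deriv g) ⟩
  derivⁿ n (deriv f ⊛ g) ⊕ derivⁿ n (f ⊛ deriv g)
    ≈⟨ ⊕-cong (derivⁿ-⊛ n (deriv f) g) (derivⁿ-⊛ n f (deriv g)) ⟩
  ∑ n (λ k → (n C k) ×ₚ (derivⁿ k (deriv f) ⊛ derivⁿ (n ∸ k) g)) ⊕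
  ∑ n (λ k → (n C k) ×ₚ (derivⁿ k f ⊛ derivⁿ (n ∸ k) (deriv g)))
    ≈⟨ ⊕-cong (∑-cong n λ {k} _ → ≈ₚ-reflexive (shiftˡ k)) (∑-cong n λ {k} k≤n → ≈ₚ-reflexive (shiftʳ k≤n)) ⟩
  ∑ n (λ k → (n C k) ×ₚ h (suc k)) ⊕ ∑ n (λ k → (n C k) ×ₚ h k)
    ≈⟨ ∑-pascal n h ⟨
  ∑ (suc n) (λ k → (suc n C k) ×ₚ h k)
    ∎
  where
  open ≈ₚ-Reasoning
  h : ℕ → Poly
  h k = derivⁿ k f ⊛ derivⁿ (suc n ∸ k) g
  shiftˡ : ∀ k → (n C k) ×ₚ (derivⁿ k (deriv f) ⊛ derivⁿ (n ∸ k) g) ≡ (n C k) ×ₚ h (suc k)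
  shiftˡ k = cong (λ p → (n C k) ×ₚ (p ⊛ derivⁿ (n ∸ k) g)) (sym (derivⁿ-sucʳ k f))
  shiftʳ : ∀ {k} → k ℕ.≤ n → (n C k) ×ₚ (derivⁿ k f ⊛ derivⁿ (n ∸ k) (deriv g)) ≡ (n C k) ×ₚ h k
  shiftʳ {k} k≤n = cong (λ p → (n C k) ×ₚ (derivⁿ k f ⊛ p))
    (trans (sym (derivⁿ-sucʳ (n ∸ k) g)) (cong (λ m → derivⁿ m g) (sym (ℕ.+-∸-assoc 1 k≤n))))

deriv-×ₚ : ∀ n p → deriv (n ×ₚ p) ≡ n ×ₚ deriv p
deriv-×ₚ zero    p = refl
deriv-×ₚ (suc n) p = trans (deriv-⊕ p (n ×ₚ p)) (cong (deriv p ⊕_) (deriv-×ₚ n p))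

deriv-^ : ∀ p n → deriv (p ^ₚ suc n) ≈ₚ suc n ×ₚ (p ^ₚ n ⊛ deriv p)
deriv-^ p zero    = ≈ₚ-trans (deriv-⊛ p (1ℚ ∷ [])) (⊕-cong (⊛-comm (deriv p) (1ℚ ∷ [])) (⊛-zeroʳ p))
deriv-^ p (suc n) = begin
  deriv (p ⊛ p ^ₚ suc n)
    ≈⟨ deriv-⊛ p (p ^ₚ suc n) ⟩
  deriv p ⊛ p ^ₚ suc n ⊕ p ⊛ deriv (p ^ₚ suc n)
    ≈⟨ ⊕-cong (⊛-comm (deriv p) (p ^ₚ suc n)) (⊛-congʳ p (deriv-^ p n)) ⟩
  p ^ₚ suc n ⊛ deriv p ⊕ p ⊛ (suc n ×ₚ (p ^ₚ n ⊛ deriv p))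
    ≈⟨ ⊕-congˡ (p ^ₚ suc n ⊛ deriv p) (×-comm-* (suc n) p _) ⟩
  p ^ₚ suc n ⊛ deriv p ⊕ suc n ×ₚ (p ⊛ (p ^ₚ n ⊛ deriv p))
    ≈⟨ ⊕-congˡ (p ^ₚ suc n ⊛ deriv p) (×-congʳ (suc n) (⊛-assoc p (p ^ₚ n) (deriv p))) ⟨
  suc (suc n) ×ₚ (p ^ₚ suc n ⊛ deriv p)
    ∎
  where open ≈ₚ-Reasoning

infix 21 X+_
X+_ : ℚ → Poly
X+ c = c ∷ 1ℚ ∷ []

deriv-X+^ : ∀ c n → deriv (X+ c ^ₚ n) ≈ₚ n ×ₚ X+ c ^ₚ ℕ.pred n
deriv-X+^ c zero    = ≈ₚ-refl
deriv-X+^ c (suc n) = ≈ₚ-trans (deriv-^ (X+ c) n) (×-congʳ (suc n) (CommutativeSemiring.*-identityʳ ℚ[X] (X+ c ^ₚ n)))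

derivⁿ-X+^ : ∀ c j n → derivⁿ j (X+ c ^ₚ n) ≈ₚ (n P′ j) ×ₚ X+ c ^ₚ (n ∸ j)
derivⁿ-X+^ c zero    n = ≈ₚ-reflexive (sym (⊕-identityʳ (X+ c ^ₚ n)))
derivⁿ-X+^ c (suc j) n = begin
  deriv (derivⁿ j (X+ c ^ₚ n))
    ≈⟨ deriv-cong (derivⁿ-X+^ c j n) ⟩
  deriv ((n P′ j) ×ₚ X+ c ^ₚ (n ∸ j))
    ≡⟨ deriv-×ₚ (n P′ j) (X+ c ^ₚ (n ∸ j)) ⟩
  (n P′ j) ×ₚ deriv (X+ c ^ₚ (n ∸ j))
    ≈⟨ ×-congʳ (n P′ j) (deriv-X+^ c (n ∸ j)) ⟩
  (n P′ j) ×ₚ ((n ∸ j) ×ₚ X+ c ^ₚ ℕ.pred (n ∸ j))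
    ≈⟨ ×-assocˡ _ (n P′ j) (n ∸ j) ⟩
  ((n P′ j) ℕ.* (n ∸ j)) ×ₚ X+ c ^ₚ ℕ.pred (n ∸ j)
    ≡⟨ cong₂ _×ₚ_ (ℕ.*-comm (n P′ j) (n ∸ j)) (cong (X+ c ^ₚ_) (ℕ.pred[m∸n]≡m∸[1+n] n j)) ⟩
  (n P′ suc j) ×ₚ X+ c ^ₚ (n ∸ suc j)
    ∎
  where open ≈ₚ-Reasoning

derivⁿ-X+^⊛X+^ : ∀ d a b →
  derivⁿ d (X+ a ^ₚ d ⊛ X+ b ^ₚ d) ≈ₚ (d !) ×ₚ ℚ[X]-Form.binomial²Form d (X+ a) (X+ b)
derivⁿ-X+^⊛X+^ d a b = begin
  derivⁿ d (X+ a ^ₚ d ⊛ X+ b ^ₚ d)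
    ≈⟨ derivⁿ-⊛ d (X+ a ^ₚ d) (X+ b ^ₚ d) ⟩
  ∑ d (λ k → (d C k) ×ₚ (derivⁿ k (X+ a ^ₚ d) ⊛ derivⁿ (d ∸ k) (X+ b ^ₚ d)))
    ≈⟨ ∑-cong d term ⟩
  ∑ d (λ k → (d !) ×ₚ ((d C² k) ×ₚ (X+ a ℚ[X].^ (d ∸ k) ⊛ X+ b ℚ[X].^ k)))
    ≈⟨ ×-distrib-∑ (d !) d _ ⟨
  (d !) ×ₚ ℚ[X]-Form.binomial²Form d (X+ a) (X+ b)
    ∎
  where
  open ≈ₚ-Reasoning
  ×ₚ-⊛-×ₚ : ∀ m n p q → (m ×ₚ p) ⊛ (n ×ₚ q) ≈ₚ (m ℕ.* n) ×ₚ (p ⊛ q)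
  ×ₚ-⊛-×ₚ m n p q = ≈ₚ-trans (×-assoc-* m p (n ×ₚ q))
    (≈ₚ-trans (×-congʳ m (×-comm-* n p q)) (×-assocˡ (p ⊛ q) m n))
  term : ∀ {k} → k ℕ.≤ d →
    (d C k) ×ₚ (derivⁿ k (X+ a ^ₚ d) ⊛ derivⁿ (d ∸ k) (X+ b ^ₚ d)) ≈ₚ
    (d !) ×ₚ ((d C² k) ×ₚ (X+ a ℚ[X].^ (d ∸ k) ⊛ X+ b ℚ[X].^ k))
  term {k} k≤d = begin
    (d C k) ×ₚ (derivⁿ k (X+ a ^ₚ d) ⊛ derivⁿ (d ∸ k) (X+ b ^ₚ d))
      ≈⟨ ×-congʳ (d C k) (⊛-cong (derivⁿ-X+^ a k d) (derivⁿ-X+^ b (d ∸ k) d)) ⟩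
    (d C k) ×ₚ ((d P′ k) ×ₚ X+ a ^ₚ (d ∸ k) ⊛ (d P′ (d ∸ k)) ×ₚ X+ b ^ₚ (d ∸ (d ∸ k)))
      ≈⟨ ×-congʳ (d C k) (×ₚ-⊛-×ₚ (d P′ k) (d P′ (d ∸ k)) _ _) ⟩
    (d C k) ×ₚ (((d P′ k) ℕ.* (d P′ (d ∸ k))) ×ₚ (X+ a ^ₚ (d ∸ k) ⊛ X+ b ^ₚ (d ∸ (d ∸ k))))
      ≈⟨ ×-assocˡ _ (d C k) _ ⟩
    ((d C k) ℕ.* ((d P′ k) ℕ.* (d P′ (d ∸ k)))) ×ₚ (X+ a ^ₚ (d ∸ k) ⊛ X+ b ^ₚ (d ∸ (d ∸ k)))
      ≡⟨ cong₂ _×ₚ_ (nCk*nP′k*nP′[n∸k]≡n!*nC²k k≤d)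
           (cong₂ _⊛_ (^ₚ≡^ (X+ a) (d ∸ k)) (trans (cong (X+ b ^ₚ_) (ℕ.m∸[m∸n]≡n k≤d)) (^ₚ≡^ (X+ b) k))) ⟩
    (d ! ℕ.* (d C² k)) ×ₚ (X+ a ℚ[X].^ (d ∸ k) ⊛ X+ b ℚ[X].^ k)
      ≈⟨ ×-assocˡ _ (d !) (d C² k) ⟨
    (d !) ×ₚ ((d C² k) ×ₚ (X+ a ℚ[X].^ (d ∸ k) ⊛ X+ b ℚ[X].^ k))
      ∎

X²-1≈X+-1⊛X+1 : X²-1 ≈ₚ X+ (ℚ.- 1ℚ) ⊛ X+ 1ℚ
X²-1≈X+-1⊛X+1 = coeffwise λ { 0 → refl ; 1 → refl ; 2 → refl ; (suc (suc (suc i))) → refl }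

X²-1^≈ : ∀ d → X²-1 ^ₚ d ≈ₚ X+ (ℚ.- 1ℚ) ^ₚ d ⊛ X+ 1ℚ ^ₚ d
X²-1^≈ d = begin
  X²-1 ^ₚ d                                           ≡⟨ ^ₚ≡^ X²-1 d ⟩
  X²-1 ℚ[X].^ d                                      ≈⟨ ℚ[X].^-congˡ d X²-1≈X+-1⊛X+1 ⟩
  (X+ (ℚ.- 1ℚ) ⊛ X+ 1ℚ) ℚ[X].^ d                     ≈⟨ ℚ[X].^-distrib-* (X+ (ℚ.- 1ℚ)) (X+ 1ℚ) d ⟩
  X+ (ℚ.- 1ℚ) ℚ[X].^ d ⊛ X+ 1ℚ ℚ[X].^ d             ≡⟨ cong₂ _⊛_ (^ₚ≡^ (X+ (ℚ.- 1ℚ)) d) (^ₚ≡^ (X+ 1ℚ) d) ⟨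
  X+ (ℚ.- 1ℚ) ^ₚ d ⊛ X+ 1ℚ ^ₚ d                       ∎
  where open ≈ₚ-Reasoning

eval-⊕ : ∀ p q x → eval (p ⊕ q) x ≡ eval p x + eval q x
eval-⊕ []      q       x = sym (ℚ.+-identityˡ (eval q x))
eval-⊕ (a ∷ p) []      x = sym (ℚ.+-identityʳ (eval (a ∷ p) x))
eval-⊕ (a ∷ p) (b ∷ q) x = trans (cong (λ v → a + b + x * v) (eval-⊕ p q x)) (lemma a b x (eval p x) (eval q x))
  where
  lemma : ∀ a b x u v → a + b + x * (u + v) ≡ (a + x * u) + (b + x * v)
  lemma = solve-∀ ℚ-ring

eval-· : ∀ c p x → eval (c · p) x ≡ c * eval p x
eval-· c []      x = sym (ℚ.*-zeroʳ c)
eval-· c (a ∷ p) x = trans (cong (λ v → c * a + x * v) (eval-· c p x)) (lemma c a x (eval p x))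
  where
  lemma : ∀ c a x u → c * a + x * (c * u) ≡ c * (a + x * u)
  lemma = solve-∀ ℚ-ring

eval-⊛ : ∀ p q x → eval (p ⊛ q) x ≡ eval p x * eval q x
eval-⊛ []      q x = sym (ℚ.*-zeroˡ (eval q x))
eval-⊛ (a ∷ p) q x = begin
  eval (a · q ⊕ (0ℚ ∷ (p ⊛ q))) x
    ≡⟨ eval-⊕ (a · q) (0ℚ ∷ (p ⊛ q)) x ⟩
  eval (a · q) x + (0ℚ + x * eval (p ⊛ q) x) ≡⟨ cong₂ (λ u v → u + (0ℚ + x * v)) (eval-· a q x) (eval-⊛ p q x) ⟩
  a * eval q x + (0ℚ + x * (eval p x * eval q x)) ≡⟨ lemma a x (eval p x) (eval q x) ⟩
  (a + x * eval p x) * eval q x              ∎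
  where
  open ≡-Reasoning
  lemma : ∀ a x u v → a * v + (0ℚ + x * (u * v)) ≡ (a + x * u) * v
  lemma = solve-∀ ℚ-ring

eval-≈[] : ∀ {p} x → p ≈ₚ [] → eval p x ≡ 0ℚ
eval-≈[] {[]}    x p≈[] = refl
eval-≈[] {a ∷ p} x p≈[] = begin
  a + x * eval p x
    ≡⟨ cong₂ (λ u v → u + x * v) (coeff-≡ p≈[] 0) (eval-≈[] {p} x (coeffwise (λ i → coeff-≡ p≈[] (suc i)))) ⟩
  0ℚ + x * 0ℚ
    ≡⟨ cong (0ℚ +_) (ℚ.*-zeroʳ x) ⟩
  0ℚ
    ∎
  where open ≡-Reasoning

eval-cong : ∀ {p q} x → p ≈ₚ q → eval p x ≡ eval q x
eval-cong {[]}    {[]}    x p≈q = refl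
eval-cong {a ∷ p} {[]}    x p≈q = eval-≈[] x p≈q
eval-cong {[]}    {b ∷ q} x p≈q = sym (eval-≈[] x (≈ₚ-sym p≈q))
eval-cong {a ∷ p} {b ∷ q} x p≈q =
  cong₂ (λ u v → u + x * v) (coeff-≡ p≈q 0) (eval-cong {p} {q} x (coeffwise (λ i → coeff-≡ p≈q (suc i))))

eval-at-0 : ∀ p → eval p 0ℚ ≡ coeff p 0
eval-at-0 []      = refl
eval-at-0 (a ∷ p) = trans (cong (_+_ a) (ℚ.*-zeroˡ (eval p 0ℚ))) (ℚ.+-identityʳ a)

eval-isSemiringHomomorphism : ∀ x → IsSemiringHomomorphism
  (CommutativeSemiring.rawSemiring ℚ[X]) (CommutativeSemiring.rawSemiring ℚ-commutativeSemiring) (λ p → eval p x)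
eval-isSemiringHomomorphism x = record
  { isNearSemiringHomomorphism = record
    { +-isMonoidHomomorphism = record
      { isMagmaHomomorphism = record
        { isRelHomomorphism = record { cong = eval-cong x }
        ; homo = λ p q → eval-⊕ p q x
        }
      ; ε-homo = refl
      }
    ; *-homo = λ p q → eval-⊛ p q x
    }
  ; 1#-homo = trans (cong (1ℚ +_) (ℚ.*-zeroʳ x)) (ℚ.+-identityʳ 1ℚ)
  }

eval-×ₚ : ∀ n p x → eval (n ×ₚ p) x ≡ fromℕ n * eval p x
eval-×ₚ zero    p x = sym (ℚ.*-zeroˡ (eval p x))
eval-×ₚ (suc n) p x = begin
  eval (p ⊕ n ×ₚ p) x                  ≡⟨ eval-⊕ p (n ×ₚ p) x ⟩
  eval p x + eval (n ×ₚ p) x           ≡⟨ cong (_+_ (eval p x)) (eval-×ₚ n p x) ⟩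
  eval p x + fromℕ n * eval p x        ≡⟨ lemma (fromℕ n) (eval p x) ⟩
  (1ℚ + fromℕ n) * eval p x            ≡⟨ cong (_* eval p x) (fromℕ-suc n) ⟨
  fromℕ (suc n) * eval p x             ∎
  where
  open ≡-Reasoning
  lemma : ∀ m e → e + m * e ≡ (1ℚ + m) * e
  lemma = solve-∀ ℚ-ring

eval-X+ : ∀ c x → eval (X+ c) x ≡ c + x
eval-X+ c x = cong (_+_ c) (lemma x)
  where
  lemma : ∀ x → x * (1ℚ + x * 0ℚ) ≡ x
  lemma = solve-∀ ℚ-ring

module eval-homo (x : ℚ) = Binomial²FormHomomorphism ℚ[X] ℚ-commutativeSemiring (eval-isSemiringHomomorphism x)

eval-derivⁿ-X²-1^ : ∀ d x →
  eval (derivⁿ d (X²-1 ^ₚ d)) x ≡ fromℕ (d !) * ℚ-Form.binomial²Form d (- 1ℚ + x) (1ℚ + x)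
eval-derivⁿ-X²-1^ d x = begin
  eval (derivⁿ d (X²-1 ^ₚ d)) x
    ≡⟨ eval-cong x (≈ₚ-trans (derivⁿ-cong d (X²-1^≈ d)) (derivⁿ-X+^⊛X+^ d (- 1ℚ) 1ℚ)) ⟩
  eval ((d !) ×ₚ ℚ[X]-Form.binomial²Form d (X+ (- 1ℚ)) (X+ 1ℚ)) x
    ≡⟨ eval-×ₚ (d !) _ x ⟩
  fromℕ (d !) * eval (ℚ[X]-Form.binomial²Form d (X+ (- 1ℚ)) (X+ 1ℚ)) x
    ≡⟨ cong (fromℕ (d !) *_) (eval-homo.binomial²Form-homo x d (X+ (- 1ℚ)) (X+ 1ℚ)) ⟩
  fromℕ (d !) * ℚ-Form.binomial²Form d (eval (X+ (- 1ℚ)) x) (eval (X+ 1ℚ) x)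
    ≡⟨ cong₂ (λ u v → fromℕ (d !) * ℚ-Form.binomial²Form d u v) (eval-X+ (- 1ℚ) x) (eval-X+ 1ℚ x) ⟩
  fromℕ (d !) * ℚ-Form.binomial²Form d (- 1ℚ + x) (1ℚ + x)
    ∎
  where open ≡-Reasoning

-- Legendre polynomials

-- Written exactly as in the definition of legendre, so that eval-· applies to it.
legendreScale : ℕ → ℚ
legendreScale d = (ℤ.+ 1 / (2 ℕ.^ d ℕ.* d !)) {{ℕ.m*n≢0 (2 ℕ.^ d) (d !) {{ℕ.m^n≢0 2 d}} {{d ℕ.!≢0}}}}

legendreScale≢0 : ∀ d → legendreScale d ≢ 0ℚ
legendreScale≢0 d eq with subst (λ q → ℚ.↥ q ℤ.* gcd (ℤ.+ 1) (ℤ.+ (2 ℕ.^ d ℕ.* d !)) ≡ ℤ.+ 1) eq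
                            (ℚ.↥-/ (ℤ.+ 1) (2 ℕ.^ d ℕ.* d !) {{ℕ.m*n≢0 (2 ℕ.^ d) (d !) {{ℕ.m^n≢0 2 d}} {{d ℕ.!≢0}}}})
... | ()

legendre-root⇒binomial²Form-root : ∀ d x → eval (legendre d) x ≡ 0ℚ →
  ℚ-Form.binomial²Form d (- 1ℚ + x) (1ℚ + x) ≡ 0ℚ
legendre-root⇒binomial²Form-root d x root =
  *-cancelˡ-≡0 (fromℕ≢0 (d !) {{d ℕ.!≢0}}) (*-cancelˡ-≡0 (legendreScale≢0 d) (begin
    legendreScale d * (fromℕ (d !) * ℚ-Form.binomial²Form d (- 1ℚ + x) (1ℚ + x))
      ≡⟨ cong (legendreScale d *_) (eval-derivⁿ-X²-1^ d x) ⟨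
    legendreScale d * eval (derivⁿ d (X²-1 ^ₚ d)) x
      ≡⟨ eval-· (legendreScale d) (derivⁿ d (X²-1 ^ₚ d)) x ⟨
    eval (legendre d) x
      ≡⟨ root ⟩
    0ℚ ∎))
  where open ≡-Reasoning

legendre-root≡0 : ∀ d → d ≥ 1 → ∀ x → eval (legendre d) x ≡ 0ℚ → x ≡ 0ℚ
legendre-root≡0 (suc m) _ x root = begin
  x                ≡⟨ x≡1+[-1+x] x ⟩
  1ℚ + (- 1ℚ + x)  ≡⟨ cong (_+_ 1ℚ) 2u≡-1+x ⟨
  1ℚ + 2ℚ * u      ≡⟨ cong (λ v → 1ℚ + 2ℚ * v) u≡-½ ⟩
  1ℚ + 2ℚ * ℚ.-½   ≡⟨⟩
  0ℚ               ∎
  where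
  open ≡-Reasoning
  2ℚ : ℚ
  2ℚ = fromℕ 2
  u : ℚ
  u = ℚ.½ * (- 1ℚ + x)
  x≡1+[-1+x] : ∀ y → y ≡ 1ℚ + (- 1ℚ + y)
  x≡1+[-1+x] = solve-∀ ℚ-ring
  2u≡-1+x : 2ℚ * u ≡ - 1ℚ + x
  2u≡-1+x = trans (sym (ℚ.*-assoc 2ℚ ℚ.½ (- 1ℚ + x))) (ℚ.*-identityˡ (- 1ℚ + x))
  2[u+1]≡1+x : 2ℚ * (u + 1ℚ) ≡ 1ℚ + x
  2[u+1]≡1+x = trans (ℚ.*-distribˡ-+ 2ℚ u 1ℚ) (trans (cong (_+ 2ℚ * 1ℚ) 2u≡-1+x) (lemma x))
    where
    lemma : ∀ y → - 1ℚ + y + (1ℚ + 1ℚ) ≡ 1ℚ + y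
    lemma = solve-∀ ℚ-ring
  u≡-½ : u ≡ ℚ.-½
  u≡-½ = binomial²Form[u,u+1]≡0⇒u≡-½ m u (*-cancelˡ-≡0 (^-≢0 {2ℚ} (λ ()) (suc m)) (begin
    2ℚ ^ suc m * ℚ-Form.binomial²Form (suc m) u (u + 1ℚ)
      ≡⟨ ℚ-Form.binomial²Form-homogeneous (suc m) 2ℚ u (u + 1ℚ) ⟨
    ℚ-Form.binomial²Form (suc m) (2ℚ * u) (2ℚ * (u + 1ℚ))
      ≡⟨ cong₂ (ℚ-Form.binomial²Form (suc m)) 2u≡-1+x 2[u+1]≡1+x ⟩
    ℚ-Form.binomial²Form (suc m) (- 1ℚ + x) (1ℚ + x)
      ≡⟨ legendre-root⇒binomial²Form-root (suc m) x root ⟩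
    0ℚ
      ∎))

coeff-X²-1⊛ : ∀ p i → coeff (X²-1 ⊛ p) i ≡ - 1ℚ * coeff p i + coeff (0ℚ ∷ 0ℚ ∷ p) i
coeff-X²-1⊛ p i = begin
  coeff (X²-1 ⊛ p) i
    ≡⟨ coeff-≡ X²-1⊛p≈ i ⟩
  coeff ((- 1ℚ) · p ⊕ (0ℚ ∷ 0ℚ ∷ p)) i
    ≡⟨ coeff-⊕ ((- 1ℚ) · p) (0ℚ ∷ 0ℚ ∷ p) i ⟩
  coeff ((- 1ℚ) · p) i + coeff (0ℚ ∷ 0ℚ ∷ p) i
    ≡⟨ cong (_+ coeff (0ℚ ∷ 0ℚ ∷ p) i) (coeff-· (- 1ℚ) p i) ⟩
  - 1ℚ * coeff p i + coeff (0ℚ ∷ 0ℚ ∷ p) i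
    ∎
  where
  open ≡-Reasoning
  X²-1⊛p≈ : X²-1 ⊛ p ≈ₚ (- 1ℚ) · p ⊕ (0ℚ ∷ 0ℚ ∷ p)
  X²-1⊛p≈ = ⊕-congˡ ((- 1ℚ) · p) (∷-cong refl (⊕-cong (·-zeroˡ p) (∷-cong refl (⊛-identityˡ p))))

-- The sign (-1)^(d+k) stands for (-1)^(d-k), which truncated subtraction would garble.
coeff-X²-1^ : ∀ d k → coeff (X²-1 ^ₚ d) (k ℕ.+ k) ≡ (- 1ℚ) ^ (d ℕ.+ k) * fromℕ (d C k)
coeff-X²-1^ zero    zero    = refl
coeff-X²-1^ zero    (suc k) = sym (ℚ.*-zeroʳ ((- 1ℚ) ^ suc k))
coeff-X²-1^ (suc d) zero    = begin
  coeff (X²-1 ⊛ X²-1 ^ₚ d) 0                  ≡⟨ coeff-X²-1⊛ (X²-1 ^ₚ d) 0 ⟩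
  - 1ℚ * coeff (X²-1 ^ₚ d) 0 + 0ℚ             ≡⟨ cong (λ c → - 1ℚ * c + 0ℚ) (coeff-X²-1^ d 0) ⟩
  - 1ℚ * ((- 1ℚ) ^ (d ℕ.+ 0) * fromℕ 1) + 0ℚ  ≡⟨ lemma ((- 1ℚ) ^ (d ℕ.+ 0)) (fromℕ 1) ⟩
  (- 1ℚ) ^ (suc d ℕ.+ 0) * fromℕ 1            ∎
  where
  open ≡-Reasoning
  lemma : ∀ e c → - 1ℚ * (e * c) + 0ℚ ≡ (- 1ℚ * e) * c
  lemma = solve-∀ ℚ-ring
coeff-X²-1^ (suc d) (suc k) = begin
  coeff (X²-1 ^ₚ suc d) (suc (k ℕ.+ suc k))
    ≡⟨ cong (λ i → coeff (X²-1 ^ₚ suc d) (suc i)) (ℕ.+-suc k k) ⟩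
  coeff (X²-1 ⊛ P) (suc (suc (k ℕ.+ k)))
    ≡⟨ coeff-X²-1⊛ P (suc (suc (k ℕ.+ k))) ⟩
  - 1ℚ * coeff P (suc (suc (k ℕ.+ k))) + coeff P (k ℕ.+ k)
    ≡⟨ cong (λ i → - 1ℚ * coeff P (suc i) + coeff P (k ℕ.+ k)) (ℕ.+-suc k k) ⟨
  - 1ℚ * coeff P (suc k ℕ.+ suc k) + coeff P (k ℕ.+ k)
    ≡⟨ cong₂ (λ u v → - 1ℚ * u + v) (coeff-X²-1^ d (suc k)) (coeff-X²-1^ d k) ⟩
  - 1ℚ * ((- 1ℚ) ^ (d ℕ.+ suc k) * fromℕ (d C suc k)) + e * fromℕ (d C k)
    ≡⟨ cong (λ n → - 1ℚ * ((- 1ℚ) ^ n * fromℕ (d C suc k)) + e * fromℕ (d C k)) (ℕ.+-suc d k) ⟩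
  - 1ℚ * ((- 1ℚ * e) * fromℕ (d C suc k)) + e * fromℕ (d C k)
    ≡⟨ lemma e (fromℕ (d C k)) (fromℕ (d C suc k)) ⟩
  (- 1ℚ * (- 1ℚ * e)) * (fromℕ (d C k) + fromℕ (d C suc k))
    ≡⟨ cong₂ (λ n c → (- 1ℚ) ^ suc n * c) (ℕ.+-suc d k) pascal ⟨
  (- 1ℚ) ^ (suc d ℕ.+ suc k) * fromℕ (suc d C suc k)
    ∎
  where
  open ≡-Reasoning
  P = X²-1 ^ₚ d
  e = (- 1ℚ) ^ (d ℕ.+ k)
  pascal : fromℕ (suc d C suc k) ≡ fromℕ (d C k) + fromℕ (d C suc k)
  pascal = trans (cong fromℕ (sym (nCk+nC[k+1]≡[n+1]C[k+1] d k))) (fromℤ-+ (ℤ.+ (d C k)) (ℤ.+ (d C suc k)))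
  lemma : ∀ e a b → - 1ℚ * ((- 1ℚ * e) * b) + e * a ≡ (- 1ℚ * (- 1ℚ * e)) * (a + b)
  lemma = solve-∀ ℚ-ring

legendre[2m][0]≢0 : ∀ m → eval (legendre (m ℕ.+ m)) 0ℚ ≢ 0ℚ
legendre[2m][0]≢0 m = subst (_≢ 0ℚ) (sym value) nonzero
  where
  d = m ℕ.+ m
  value : eval (legendre d) 0ℚ ≡ legendreScale d * (fromℕ (d !) * ((- 1ℚ) ^ (d ℕ.+ m) * fromℕ (d C m)))
  value = begin
    eval (legendre d) 0ℚ
      ≡⟨ eval-· (legendreScale d) (derivⁿ d (X²-1 ^ₚ d)) 0ℚ ⟩
    legendreScale d * eval (derivⁿ d (X²-1 ^ₚ d)) 0ℚ
      ≡⟨ cong (legendreScale d *_) (eval-at-0 (derivⁿ d (X²-1 ^ₚ d))) ⟩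
    legendreScale d * coeff (derivⁿ d (X²-1 ^ₚ d)) 0
      ≡⟨ cong (legendreScale d *_) (coeff₀-derivⁿ d (X²-1 ^ₚ d)) ⟩
    legendreScale d * (fromℕ (d !) * coeff (X²-1 ^ₚ d) d)
      ≡⟨ cong (λ c → legendreScale d * (fromℕ (d !) * c)) (coeff-X²-1^ d m) ⟩
    legendreScale d * (fromℕ (d !) * ((- 1ℚ) ^ (d ℕ.+ m) * fromℕ (d C m))) ∎
    where open ≡-Reasoning
  nonzero : legendreScale d * (fromℕ (d !) * ((- 1ℚ) ^ (d ℕ.+ m) * fromℕ (d C m))) ≢ 0ℚ
  nonzero = *-≢0 (legendreScale≢0 d) (*-≢0 (fromℕ≢0 (d !) {{d ℕ.!≢0}})
    (*-≢0 (^-≢0 (λ ()) (d ℕ.+ m)) (fromℕ≢0 (d C m) {{ℕ.≢-nonZero (nCk≢0 (ℕ.m≤m+n m m))}})))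

open import Data.Product using (_×_)

mainTheorem2 : (d : ℕ) → d ≥ 1 →
    ((2 ∣ d → (q : ℚ) → eval (legendre d) q ≢ 0ℚ) ×
     (¬ (2 ∣ d) → (q : ℚ) → q ≢ 0ℚ → eval (legendre d) q ≢ 0ℚ))
mainTheorem2 d d≥1 = even , odd
  where
  even : 2 ∣ d → (q : ℚ) → eval (legendre d) q ≢ 0ℚ
  even (divides m d≡m*2) q root with legendre-root≡0 d d≥1 q root
  ... | refl = legendre[2m][0]≢0 m (subst (λ n → eval (legendre n) 0ℚ ≡ 0ℚ) (trans d≡m*2 (m*2≡m+m m)) root)
    where
    m*2≡m+m : ∀ m → m ℕ.* 2 ≡ m ℕ.+ m
    m*2≡m+m m = trans (ℕ.*-comm m 2) (cong (m ℕ.+_) (ℕ.+-identityʳ m))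
  odd : ¬ (2 ∣ d) → (q : ℚ) → q ≢ 0ℚ → eval (legendre d) q ≢ 0ℚ
  odd _ q q≢0 root = q≢0 (legendre-root≡0 d d≥1 q root)
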